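{- Let $b\ge2$, $N\ge1$, and let $A=(a_0,\ldots,a_{b-1})$ be a zero-sum vector. Then the polynomial equation \[ F_N(x;A)=P_N(x;C_N)\prod_{m=0}^{N-1}\bigl(1-x^{b^m}\bigr) \] has a solution $P_N(x;C_N)=\sum_{n=0}^{b^N-1}c_nx^n$ whose coefficients are given, for $0\le n\le b^N-1$, by \[ c_n=\sum_{k\in I_b(n)}a_{u_b(k)},\qquad I_b(n)=\{k\in\mathbb{N}: k\preceq n\}. \] Moreover, $c_n=0$ for all $n$ whose base-$b$ expansion contains the digit $b-1$.
   Context: A zero-sum vector is a tuple $(a_0,\dots,a_{b-1})$ of complex numbers with $a_0+\cdots+a_{b-1}=0$. For a non-negative integer $n$ with base-$b$ digits $n_0,\dots,n_d$, $u_b(n)=\sum_j n_j \bmod b\in\{0,\dots,b-1\}$. $F_N(x;A)=\sum_{n=0}^{b^N-1}a_{u_b(n)}x^n$. Digital dominance: $k\preceq n$ means every base-$b$ digit of $k$ is at most the corresponding base-$b$ digit of $n$; $\mathbb{N}$ includes $0$. -}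

module Defs where

open import Level using (Level)
open import Data.Nat using (ℕ; zero; suc; _+_; _*_; _∸_; _^_; _≤_; _<_; NonZero; _≤ᵇ_)
open import Data.Nat.Properties using (m^n≢0)
open import Data.Nat.DivMod using (_/_; _%_; _mod_)
open import Data.Fin using (Fin)
open import Data.Bool using (Bool; true; false; _∧_; if_then_else_)
open import Data.List using (List; []; _∷_; replicate; _++_; [_])
open import Data.Product using (∃)
open import Relation.Binary.PropositionalEquality using (_≡_)
open import Algebra.Bundles using (CommutativeRing)

digit : (b : ℕ) .{{_ : NonZero b}} → ℕ → ℕ → ℕ
digit b j n = (n / (b ^ j)) {{m^n≢0 b j}} % b

digitSumUpTo : (b : ℕ) .{{_ : NonZero b}} → ℕ → ℕ → ℕ
digitSumUpTo b zero    n = 0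
digitSumUpTo b (suc m) n = digit b m n + digitSumUpTo b m n

-- sum of ALL base-b digits of n (for b ≥ 2, digits at positions ≥ n+1 are 0)
digitSum : (b : ℕ) .{{_ : NonZero b}} → ℕ → ℕ
digitSum b n = digitSumUpTo b (suc n) n

u : (b : ℕ) .{{_ : NonZero b}} → ℕ → Fin b
u b n = digitSum b n mod b

_⪯[_]_ : ℕ → (b : ℕ) .{{_ : NonZero b}} → ℕ → Set
k ⪯[ b ] n = ∀ j → digit b j k ≤ digit b j n

-- Boolean test of k ⪯ n used to compute the (finite) sum over I_b(n).
-- For b ≥ 2 and k ≤ n, all digits at positions ≥ n+1 of k and n are 0,
-- so checking positions 0..n suffices.
domUpTo : (b : ℕ) .{{_ : NonZero b}} → ℕ → ℕ → ℕ → Bool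
domUpTo b zero    k n = true
domUpTo b (suc m) k n = (digit b m k ≤ᵇ digit b m n) ∧ domUpTo b m k n

dom? : (b : ℕ) .{{_ : NonZero b}} → ℕ → ℕ → Bool
dom? b k n = domUpTo b (suc n) k n

hasDigit : (b : ℕ) .{{_ : NonZero b}} → ℕ → ℕ → Set
hasDigit b d n = ∃ λ j → digit b j n ≡ d

module Poly {c ℓ : Level} (R : CommutativeRing c ℓ) where
  open CommutativeRing R using (Carrier; _≈_; 0#; 1#; -_) renaming (_+_ to _⊕_; _*_ to _⊗_)

  Pol : Set c
  Pol = List Carrier

  coeff : Pol → ℕ → Carrier
  coeff []       i       = 0#
  coeff (a ∷ p)  zero    = a
  coeff (a ∷ p)  (suc i) = coeff p i

  _≈ₚ_ : Pol → Pol → Set ℓ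
  p ≈ₚ q = ∀ i → coeff p i ≈ coeff q i

  _+ₚ_ : Pol → Pol → Pol
  []      +ₚ q       = q
  (a ∷ p) +ₚ []      = a ∷ p
  (a ∷ p) +ₚ (b ∷ q) = (a ⊕ b) ∷ (p +ₚ q)

  scale : Carrier → Pol → Pol
  scale a []      = []
  scale a (b ∷ p) = (a ⊗ b) ∷ scale a p

  _*ₚ_ : Pol → Pol → Pol
  []      *ₚ q = []
  (a ∷ p) *ₚ q = scale a q +ₚ (0# ∷ (p *ₚ q))

  oneₚ : Pol
  oneₚ = [ 1# ]

  oneMinusXPow : ℕ → Pol
  oneMinusXPow zero    = []                       -- 1 - x^0 = 0
  oneMinusXPow (suc e) = 1# ∷ (replicate e 0# ++ [ - 1# ])

  fromFun : ℕ → (ℕ → Carrier) → Pol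
  fromFun zero    f = []
  fromFun (suc m) f = f 0 ∷ fromFun m (λ i → f (suc i))

  sumTo : ℕ → (ℕ → Carrier) → Carrier
  sumTo zero    f = 0#
  sumTo (suc m) f = sumTo m f ⊕ f m

  sumFin : (n : ℕ) → (Fin n → Carrier) → Carrier
  sumFin zero    f = 0#
  sumFin (suc n) f = f Fin.zero ⊕ sumFin n (λ i → f (Fin.suc i))
    where import Data.Fin as Fin

  ZeroSum : (b : ℕ) → (Fin b → Carrier) → Set ℓ
  ZeroSum b a = sumFin b a ≈ 0#

  module _ (b : ℕ) .{{_ : NonZero b}} (a : Fin b → Carrier) where

    F : ℕ → Pol
    F N = fromFun (b ^ N) (λ n → a (u b n))

    -- c_n = Σ_{k ∈ I_b(n)} a_{u_b(k)},  I_b(n) = {k : k ⪯ n} ⊆ {0..n}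
    cc : ℕ → Carrier
    cc n = sumTo (suc n) (λ k → if dom? b k n then a (u b k) else 0#)

    P : ℕ → Pol
    P N = fromFun (b ^ N) cc

  prodFactors : (b : ℕ) → ℕ → Pol
  prodFactors b zero    = oneₚ
  prodFactors b (suc N) = prodFactors b N *ₚ oneMinusXPow (b ^ N)

module Submission where

-- Write n = m + d b^N with m < b^N and d < b. Then u_b(n) ≡ u_b(m) + d (mod b), and k ⪯ n iff
-- k = k′ + d′ b^N with d′ ≤ d and k′ ⪯ m, so c_n(A) = Σ_{d′ ≤ d} c_m(rot_{d′} A), where
-- (rot_{d′} A)_i = a_{i + d′ mod b}; that is,
-- P_{N+1}(A) = Σ_{d<b} x^{d b^N} Σ_{d′≤d} P_N(rot_{d′} A). By induction on N (from N = 0),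
-- P_N(rot A) ∏_{m<N} (1 - x^{b^m}) = F_N(rot A); the last factor 1 - x^{b^N} then telescopes
-- the partial sums over d′ into Σ_{d<b} x^{d b^N} F_N(rot_d A) = F_{N+1}(A), up to the term
-- x^{b^{N+1}} Σ_{d<b} F_N(rot_d A), which vanishes because the b rotations of a zero-sum vector
-- sum to zero in every coordinate. The same column sum gives c_n = 0 when the leading digit of n
-- is b - 1, and a digit b - 1 further down passes from n to m.

open import Defs
open import Level using (Level; _⊔_)
open import Function using (_∘_; id)
open import Data.Nat as ℕ using (ℕ; zero; suc; _∸_; _^_; _≤_; _<_; _≤ᵇ_; NonZero; z≤n; s≤s)
import Data.Nat.Properties as ℕₚ
open import Data.Nat.DivMod using (_/_; _%_; +-distrib-/-∣ʳ; m*n/n≡m; %-distribˡ-+; m%n%n≡m%n)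
open import Data.Nat.Divisibility using (n∣m*n)
open import Data.Fin using (Fin; toℕ)
import Data.Fin as Fin
open import Data.Bool using (Bool; true; false; if_then_else_; T)
open import Data.List using ([]; _∷_; replicate; _++_; [_])
open import Data.Product using (_×_; _,_)
open import Data.Empty using (⊥-elim)
open import Relation.Nullary using (¬_)
open import Relation.Binary.PropositionalEquality as ≡ using (_≡_; _≢_)
open import Algebra.Bundles using (CommutativeRing)

if-T : ∀ {a} {A : Set a} {x : Bool} {y z : A} → T x → (if x then y else z) ≡ y
if-T {x = true} _ = ≡.refl

if-¬T : ∀ {a} {A : Set a} {x : Bool} {y z : A} → ¬ T x → (if x then y else z) ≡ z
if-¬T {x = false} _  = ≡.refl
if-¬T {x = true}  ¬t = ⊥-elim (¬t _)

[m+kn]/n≡m/n+k : ∀ m k n .{{_ : NonZero n}} → (m ℕ.+ k ℕ.* n) / n ≡ m / n ℕ.+ k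
[m+kn]/n≡m/n+k m k n = ≡.trans (+-distrib-/-∣ʳ m (n∣m*n k)) (≡.cong (m / n ℕ.+_) (m*n/n≡m k n))

[m%n+k]%n≡[m+k]%n : ∀ m k n .{{_ : NonZero n}} → (m % n ℕ.+ k) % n ≡ (m ℕ.+ k) % n
[m%n+k]%n≡[m+k]%n m k n = begin
  (m % n ℕ.+ k) % n          ≡⟨ %-distribˡ-+ (m % n) k n ⟩
  (m % n % n ℕ.+ k % n) % n  ≡⟨ ≡.cong (λ x → (x ℕ.+ k % n) % n) (m%n%n≡m%n m n) ⟩
  (m % n ℕ.+ k % n) % n      ≡⟨ %-distribˡ-+ m k n ⟨
  (m ℕ.+ k) % n              ∎
  where open ≡.≡-Reasoning

module FiniteSums {c ℓ : Level} (R : CommutativeRing c ℓ) where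
  open CommutativeRing R
  open Poly R using (sumTo; sumFin)
  open import Algebra.Properties.CommutativeSemigroup +-commutativeSemigroup using (interchange)
  open import Relation.Binary.Reasoning.Setoid setoid

  sumTo-cong : ∀ n {f g : ℕ → Carrier} → (∀ i → i < n → f i ≈ g i) → sumTo n f ≈ sumTo n g
  sumTo-cong zero    f≈g = refl
  sumTo-cong (suc n) f≈g = +-cong (sumTo-cong n (λ i i<n → f≈g i (ℕₚ.m<n⇒m<1+n i<n))) (f≈g n (ℕₚ.n<1+n n))

  sumTo-zero : ∀ n {f : ℕ → Carrier} → (∀ i → i < n → f i ≈ 0#) → sumTo n f ≈ 0#
  sumTo-zero zero    f≈0 = refl
  sumTo-zero (suc n) f≈0 =
    trans (+-cong (sumTo-zero n (λ i i<n → f≈0 i (ℕₚ.m<n⇒m<1+n i<n))) (f≈0 n (ℕₚ.n<1+n n))) (+-identityʳ 0#)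

  sumTo-+ : ∀ n f g → sumTo n (λ i → f i + g i) ≈ sumTo n f + sumTo n g
  sumTo-+ zero    f g = sym (+-identityʳ 0#)
  sumTo-+ (suc n) f g = trans (+-congʳ (sumTo-+ n f g)) (interchange _ _ _ _)

  sumTo-comm : ∀ m n (F : ℕ → ℕ → Carrier) →
               sumTo m (λ d → sumTo n (F d)) ≈ sumTo n (λ k → sumTo m (λ d → F d k))
  sumTo-comm zero    n F = sym (sumTo-zero n (λ _ _ → refl))
  sumTo-comm (suc m) n F = trans (+-congʳ (sumTo-comm m n F)) (sym (sumTo-+ n _ _))

  sumTo-head : ∀ n f → sumTo (suc n) f ≈ f 0 + sumTo n (f ∘ suc)
  sumTo-head zero    f = trans (+-identityˡ _) (sym (+-identityʳ _))
  sumTo-head (suc n) f = trans (+-congʳ (sumTo-head n f)) (+-assoc _ _ _)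

  sumTo-split : ∀ m n f → sumTo (m ℕ.+ n) f ≈ sumTo m f + sumTo n (λ i → f (m ℕ.+ i))
  sumTo-split m zero    f rewrite ℕₚ.+-identityʳ m = sym (+-identityʳ _)
  sumTo-split m (suc n) f rewrite ℕₚ.+-suc m n = trans (+-congʳ (sumTo-split m n f)) (+-assoc _ _ _)

  sumTo-zero-tail : ∀ m n {f : ℕ → Carrier} → m ≤ n → (∀ i → m ≤ i → i < n → f i ≈ 0#) →
                    sumTo n f ≈ sumTo m f
  sumTo-zero-tail m n {f} m≤n tail≈0 = begin
    sumTo n f                                             ≡⟨ ≡.cong (λ k → sumTo k f) (ℕₚ.m+[n∸m]≡n m≤n) ⟨
    sumTo (m ℕ.+ (n ∸ m)) f                               ≈⟨ sumTo-split m (n ∸ m) f ⟩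
    sumTo m f + sumTo (n ∸ m) (λ i → f (m ℕ.+ i))        ≈⟨ +-congˡ (sumTo-zero (n ∸ m) tail′≈0) ⟩
    sumTo m f + 0#                                        ≈⟨ +-identityʳ _ ⟩
    sumTo m f                                             ∎
    where
    tail′≈0 : ∀ i → i < n ∸ m → f (m ℕ.+ i) ≈ 0#
    tail′≈0 i i< = tail≈0 (m ℕ.+ i) (ℕₚ.m≤m+n m i)
                     (≡.subst (m ℕ.+ i <_) (ℕₚ.m+[n∸m]≡n m≤n) (ℕₚ.+-monoʳ-< m i<))

  sumTo-if : ∀ n x (g : ℕ → Carrier) → sumTo n (λ k → if x then g k else 0#) ≈ (if x then sumTo n g else 0#)
  sumTo-if n true  g = refl
  sumTo-if n false g = sumTo-zero n (λ _ _ → refl)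

  sumTo-blocks : ∀ c E f → sumTo (c ℕ.* E) f ≈ sumTo c (λ d → sumTo E (λ k → f (k ℕ.+ d ℕ.* E)))
  sumTo-blocks zero    E f = refl
  sumTo-blocks (suc c) E f = begin
    sumTo (E ℕ.+ c ℕ.* E) f
      ≡⟨ ≡.cong (λ n → sumTo n f) (ℕₚ.+-comm E (c ℕ.* E)) ⟩
    sumTo (c ℕ.* E ℕ.+ E) f
      ≈⟨ sumTo-split (c ℕ.* E) E f ⟩
    sumTo (c ℕ.* E) f + sumTo E (λ k → f (c ℕ.* E ℕ.+ k))
      ≈⟨ +-cong (sumTo-blocks c E f) (sumTo-cong E (λ k _ → reflexive (≡.cong f (ℕₚ.+-comm (c ℕ.* E) k)))) ⟩
    sumTo (suc c) (λ d → sumTo E (λ k → f (k ℕ.+ d ℕ.* E)))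
      ∎

  sumTo-rotate : ∀ p (A : ℕ → Carrier) → A p ≈ A 0 → sumTo p (A ∘ suc) ≈ sumTo p A
  sumTo-rotate zero    A _      = refl
  sumTo-rotate (suc p) A Ap≈A0 = begin
    sumTo p (A ∘ suc) + A (suc p)  ≈⟨ +-congˡ Ap≈A0 ⟩
    sumTo p (A ∘ suc) + A 0        ≈⟨ +-comm _ _ ⟩
    A 0 + sumTo p (A ∘ suc)        ≈⟨ sumTo-head p A ⟨
    sumTo (suc p) A                ∎

  sumTo-periodic : ∀ p (A : ℕ → Carrier) → (∀ t → A (p ℕ.+ t) ≈ A t) →
                   ∀ x → sumTo p (λ j → A (x ℕ.+ j)) ≈ sumTo p A
  sumTo-periodic p A periodic zero    = refl
  sumTo-periodic p A periodic (suc x) = begin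
    sumTo p (λ j → A (suc (x ℕ.+ j)))  ≈⟨ sumTo-periodic p (A ∘ suc) periodic-suc x ⟩
    sumTo p (A ∘ suc)                   ≈⟨ sumTo-rotate p A (trans (reflexive (≡.cong A p≡p+0)) (periodic 0)) ⟩
    sumTo p A                           ∎
    where
    p≡p+0 : p ≡ p ℕ.+ 0
    p≡p+0 = ≡.sym (ℕₚ.+-identityʳ p)
    periodic-suc : ∀ t → A (suc (p ℕ.+ t)) ≈ A (suc t)
    periodic-suc t = trans (reflexive (≡.cong A (≡.sym (ℕₚ.+-suc p t)))) (periodic (suc t))

  sumFin-cong : ∀ n {f g : Fin n → Carrier} → (∀ x → f x ≈ g x) → sumFin n f ≈ sumFin n g
  sumFin-cong zero    f≈g = refl
  sumFin-cong (suc n) f≈g = +-cong (f≈g Fin.zero) (sumFin-cong n (f≈g ∘ Fin.suc))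

  sumFin≈sumTo : ∀ n (f : ℕ → Carrier) → sumFin n (f ∘ toℕ) ≈ sumTo n f
  sumFin≈sumTo zero    f = refl
  sumFin≈sumTo (suc n) f = trans (+-congˡ (sumFin≈sumTo n (f ∘ suc))) (sym (sumTo-head n f))

module Sequences {c ℓ : Level} (R : CommutativeRing c ℓ) where
  open CommutativeRing R
  open Poly R using (sumTo; coeff; fromFun)
  open import Algebra.Properties.Ring ring using (-1*x≈-x; x[y-z]≈xy-xz)
  open import Algebra.Properties.AbelianGroup +-abelianGroup using (ε⁻¹≈ε; ⁻¹-∙-comm; \\-leftDividesʳ)
  open import Algebra.Properties.CommutativeSemigroup +-commutativeSemigroup using (interchange)
  open import Relation.Binary.Reasoning.Setoid setoid

  x-0≈x : ∀ x → x - 0# ≈ x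
  x-0≈x x = trans (+-congˡ ε⁻¹≈ε) (+-identityʳ x)

  [x+y]-[z+w]≈[x-z]+[y-w] : ∀ x y z w → (x + y) - (z + w) ≈ (x - z) + (y - w)
  [x+y]-[z+w]≈[x-z]+[y-w] x y z w = trans (+-congˡ (sym (⁻¹-∙-comm z w))) (interchange x y (- z) (- w))

  [s-x]+[[x+y]-z]≈[s+y]-z : ∀ s x y z → (s - x) + ((x + y) - z) ≈ (s + y) - z
  [s-x]+[[x+y]-z]≈[s+y]-z s x y z = begin
    (s - x) + ((x + y) - z)    ≈⟨ +-congˡ (+-assoc x y (- z)) ⟩
    (s - x) + (x + (y - z))    ≈⟨ +-assoc s (- x) _ ⟩
    s + (- x + (x + (y - z)))  ≈⟨ +-congˡ (\\-leftDividesʳ x (y - z)) ⟩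
    s + (y - z)                ≈⟨ +-assoc s y (- z) ⟨
    (s + y) - z                ∎

  Seq : Set c
  Seq = ℕ → Carrier

  infix  4 _≐_
  infixl 6 _+ˢ_ _-ˢ_
  infixl 7 _·ˢ_

  _≐_ : Seq → Seq → Set ℓ
  f ≐ g = ∀ i → f i ≈ g i

  0ˢ : Seq
  0ˢ _ = 0#

  _+ˢ_ _-ˢ_ : Seq → Seq → Seq
  (f +ˢ g) i = f i + g i
  (f -ˢ g) i = f i - g i

  _·ˢ_ : Carrier → Seq → Seq
  (a ·ˢ f) i = a * f i

  Σˢ : ℕ → (ℕ → Seq) → Seq
  Σˢ n G i = sumTo n (λ d → G d i)

  record IsLinear (O : Seq → Seq) : Set (c ⊔ ℓ) where
    field
      cong   : ∀ {f g} → f ≐ g → O f ≐ O g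
      +-homo : ∀ f g → O (f +ˢ g) ≐ O f +ˢ O g
      *-homo : ∀ a f → O (a ·ˢ f) ≐ a ·ˢ O f

    0-homo : O 0ˢ ≐ 0ˢ
    0-homo i = begin
      O 0ˢ i            ≈⟨ cong (λ _ → sym (zeroˡ 0#)) i ⟩
      O (0# ·ˢ 0ˢ) i    ≈⟨ *-homo 0# 0ˢ i ⟩
      0# * O 0ˢ i       ≈⟨ zeroˡ _ ⟩
      0#                ∎

    -‿homo : ∀ f → O (λ i → - f i) ≐ (λ i → - O f i)
    -‿homo f i = begin
      O (λ j → - f j) i   ≈⟨ cong (λ j → sym (-1*x≈-x (f j))) i ⟩
      O (- 1# ·ˢ f) i     ≈⟨ *-homo (- 1#) f i ⟩
      - 1# * O f i        ≈⟨ -1*x≈-x _ ⟩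
      - O f i             ∎

    -ˢ-homo : ∀ f g → O (f -ˢ g) ≐ O f -ˢ O g
    -ˢ-homo f g i = trans (+-homo f _ i) (+-congˡ (-‿homo g i))

    Σ-homo : ∀ n G → O (Σˢ n G) ≐ Σˢ n (O ∘ G)
    Σ-homo zero    G = 0-homo
    Σ-homo (suc n) G i = trans (+-homo (Σˢ n G) (G n) i) (+-congʳ (Σ-homo n G i))

  isLinear-∘ : ∀ {O O′} → IsLinear O → IsLinear O′ → IsLinear (O ∘ O′)
  isLinear-∘ {O} {O′} lin lin′ = record
    { cong   = λ f≈g → L.cong (L′.cong f≈g)
    ; +-homo = λ f g i → trans (L.cong (L′.+-homo f g) i) (L.+-homo (O′ f) (O′ g) i)
    ; *-homo = λ a f i → trans (L.cong (L′.*-homo a f) i) (L.*-homo a (O′ f) i)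
    }
    where
    module L  = IsLinear lin
    module L′ = IsLinear lin′

  -- On coefficient sequences, shift s, restrict L, Δ e and ΔΠ b N act as multiplication by x^s,
  -- truncation to degree < L, multiplication by 1 - x^e and by ∏_{m<N} (1 - x^{b^m}).
  shift : ℕ → Seq → Seq
  shift zero    g i       = g i
  shift (suc s) g zero    = 0#
  shift (suc s) g (suc i) = shift s g i

  restrict : ℕ → Seq → Seq
  restrict L g = coeff (fromFun L g)

  Δ : ℕ → Seq → Seq
  Δ e g = g -ˢ shift e g

  ΔΠ : ℕ → ℕ → Seq → Seq
  ΔΠ b zero    = id
  ΔΠ b (suc N) = Δ (b ^ N) ∘ ΔΠ b N

  shift-isLinear : ∀ s → IsLinear (shift s)
  shift-isLinear s = record { cong = cong′ s ; +-homo = +-homo s ; *-homo = *-homo s }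
    where
    cong′ : ∀ s {f g} → f ≐ g → shift s f ≐ shift s g
    cong′ zero    f≈g i       = f≈g i
    cong′ (suc s) f≈g zero    = refl
    cong′ (suc s) f≈g (suc i) = cong′ s f≈g i
    +-homo : ∀ s f g → shift s (f +ˢ g) ≐ shift s f +ˢ shift s g
    +-homo zero    f g i       = refl
    +-homo (suc s) f g zero    = sym (+-identityʳ 0#)
    +-homo (suc s) f g (suc i) = +-homo s f g i
    *-homo : ∀ s a f → shift s (a ·ˢ f) ≐ a ·ˢ shift s f
    *-homo zero    a f i       = refl
    *-homo (suc s) a f zero    = sym (zeroʳ a)
    *-homo (suc s) a f (suc i) = *-homo s a f i

  restrict-cong : ∀ L {f g} → (∀ i → i < L → f i ≈ g i) → restrict L f ≐ restrict L g
  restrict-cong zero    f≈g i       = refl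
  restrict-cong (suc L) f≈g zero    = f≈g 0 (s≤s z≤n)
  restrict-cong (suc L) f≈g (suc i) = restrict-cong L (λ j j<L → f≈g (suc j) (s≤s j<L)) i

  restrict-isLinear : ∀ L → IsLinear (restrict L)
  restrict-isLinear L = record
    { cong = λ f≈g → restrict-cong L (λ i _ → f≈g i) ; +-homo = +-homo L ; *-homo = *-homo L }
    where
    +-homo : ∀ L f g → restrict L (f +ˢ g) ≐ restrict L f +ˢ restrict L g
    +-homo zero    f g i       = sym (+-identityʳ 0#)
    +-homo (suc L) f g zero    = refl
    +-homo (suc L) f g (suc i) = +-homo L (f ∘ suc) (g ∘ suc) i
    *-homo : ∀ L a f → restrict L (a ·ˢ f) ≐ a ·ˢ restrict L f
    *-homo zero    a f i       = sym (zeroʳ a)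
    *-homo (suc L) a f zero    = refl
    *-homo (suc L) a f (suc i) = *-homo L a (f ∘ suc) i

  shift-shift : ∀ e s g → shift e (shift s g) ≐ shift (e ℕ.+ s) g
  shift-shift zero    s g i       = refl
  shift-shift (suc e) s g zero    = refl
  shift-shift (suc e) s g (suc i) = shift-shift e s g i

  shift-comm : ∀ e s g → shift e (shift s g) ≐ shift s (shift e g)
  shift-comm e s g i = begin
    shift e (shift s g) i  ≈⟨ shift-shift e s g i ⟩
    shift (e ℕ.+ s) g i    ≡⟨ ≡.cong (λ k → shift k g i) (ℕₚ.+-comm e s) ⟩
    shift (s ℕ.+ e) g i    ≈⟨ shift-shift s e g i ⟨
    shift s (shift e g) i  ∎

  Δ-isLinear : ∀ e → IsLinear (Δ e)
  Δ-isLinear e = record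
    { cong   = λ f≈g i → +-cong (f≈g i) (-‿cong (S.cong f≈g i))
    ; +-homo = λ f g i → trans (+-congˡ (-‿cong (S.+-homo f g i))) ([x+y]-[z+w]≈[x-z]+[y-w] _ _ _ _)
    ; *-homo = λ a f i → trans (+-congˡ (-‿cong (S.*-homo a f i))) (sym (x[y-z]≈xy-xz a _ _))
    }
    where module S = IsLinear (shift-isLinear e)

  Δ-shift : ∀ e s g → Δ e (shift s g) ≐ shift s (Δ e g)
  Δ-shift e s g i = begin
    shift s g i - shift e (shift s g) i   ≈⟨ +-congˡ (-‿cong (shift-comm e s g i)) ⟩
    shift s g i - shift s (shift e g) i   ≈⟨ IsLinear.-ˢ-homo (shift-isLinear s) g (shift e g) i ⟨
    shift s (Δ e g) i                     ∎

  ΔΠ-isLinear : ∀ b N → IsLinear (ΔΠ b N)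
  ΔΠ-isLinear b zero    = record { cong = id ; +-homo = λ _ _ _ → refl ; *-homo = λ _ _ _ → refl }
  ΔΠ-isLinear b (suc N) = isLinear-∘ (Δ-isLinear (b ^ N)) (ΔΠ-isLinear b N)

  ΔΠ-shift : ∀ b N s g → ΔΠ b N (shift s g) ≐ shift s (ΔΠ b N g)
  ΔΠ-shift b zero    s g i = refl
  ΔΠ-shift b (suc N) s g i =
    trans (IsLinear.cong (Δ-isLinear (b ^ N)) (ΔΠ-shift b N s g) i) (Δ-shift (b ^ N) s (ΔΠ b N g) i)

  restrict-+ : ∀ L E h → restrict (L ℕ.+ E) h ≐ restrict L h +ˢ shift L (restrict E (λ m → h (L ℕ.+ m)))
  restrict-+ zero    E h i       = sym (+-identityˡ _)
  restrict-+ (suc L) E h zero    = sym (+-identityʳ _)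
  restrict-+ (suc L) E h (suc i) = restrict-+ L E (h ∘ suc) i

  restrict-blocks : ∀ E c h (H : ℕ → Seq) →
                    (∀ d m → d < c → m < E → h (m ℕ.+ d ℕ.* E) ≈ H d m) →
                    restrict (c ℕ.* E) h ≐ Σˢ c (λ d → shift (d ℕ.* E) (restrict E (H d)))
  restrict-blocks E zero    h H h≈H i = refl
  restrict-blocks E (suc c) h H h≈H i = begin
    restrict (E ℕ.+ c ℕ.* E) h i
      ≡⟨ ≡.cong (λ n → restrict n h i) (ℕₚ.+-comm E (c ℕ.* E)) ⟩
    restrict (c ℕ.* E ℕ.+ E) h i
      ≈⟨ restrict-+ (c ℕ.* E) E h i ⟩
    restrict (c ℕ.* E) h i + shift (c ℕ.* E) (restrict E (λ m → h (c ℕ.* E ℕ.+ m))) i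
      ≈⟨ +-cong (restrict-blocks E c h H (λ d m d<c → h≈H d m (ℕₚ.m<n⇒m<1+n d<c)) i)
                (IsLinear.cong (shift-isLinear (c ℕ.* E)) (restrict-cong E last-block) i) ⟩
    Σˢ (suc c) (λ d → shift (d ℕ.* E) (restrict E (H d))) i
      ∎
    where
    last-block : ∀ m → m < E → h (c ℕ.* E ℕ.+ m) ≈ H c m
    last-block m m<E = trans (reflexive (≡.cong h (ℕₚ.+-comm (c ℕ.* E) m))) (h≈H c m (ℕₚ.n<1+n c) m<E)

  Δ-telescope : ∀ E c (g : ℕ → Seq) →
                Δ E (Σˢ c (λ d → shift (d ℕ.* E) (Σˢ (suc d) g)))
                  ≐ Σˢ c (λ d → shift (d ℕ.* E) (g d)) -ˢ shift (c ℕ.* E) (Σˢ c g)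
  Δ-telescope E zero    g i = trans (IsLinear.0-homo (Δ-isLinear E) i) (sym (x-0≈x 0#))
  Δ-telescope E (suc c) g i = begin
    Δ E (A +ˢ shift (c ℕ.* E) H) i
      ≈⟨ IsLinear.+-homo (Δ-isLinear E) A (shift (c ℕ.* E) H) i ⟩
    Δ E A i + (shift (c ℕ.* E) H i - shift E (shift (c ℕ.* E) H) i)
      ≈⟨ +-cong (Δ-telescope E c g i)
                (+-cong (IsLinear.+-homo (shift-isLinear (c ℕ.* E)) (Σˢ c g) (g c) i)
                        (-‿cong (shift-shift E (c ℕ.* E) H i))) ⟩
    (S - X) + ((X + Y) - shift (suc c ℕ.* E) H i)
      ≈⟨ [s-x]+[[x+y]-z]≈[s+y]-z S X Y _ ⟩
    (S + Y) - shift (suc c ℕ.* E) H i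
      ∎
    where
    A H : Seq
    A = Σˢ c (λ d → shift (d ℕ.* E) (Σˢ (suc d) g))
    H = Σˢ (suc c) g
    S X Y : Carrier
    S = Σˢ c (λ d → shift (d ℕ.* E) (g d)) i
    X = shift (c ℕ.* E) (Σˢ c g) i
    Y = shift (c ℕ.* E) (g c) i

module PolynomialProducts {c ℓ : Level} (R : CommutativeRing c ℓ) where
  open CommutativeRing R
  open Poly R
  open Sequences R
  open import Algebra.Properties.AbelianGroup +-abelianGroup using (ε⁻¹≈ε)
  open import Relation.Binary.Reasoning.Setoid setoid

  coeff-+ₚ : ∀ p q → coeff (p +ₚ q) ≐ coeff p +ˢ coeff q
  coeff-+ₚ []      q       i       = sym (+-identityˡ _)
  coeff-+ₚ (x ∷ p) []      i       = sym (+-identityʳ _)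
  coeff-+ₚ (x ∷ p) (y ∷ q) zero    = refl
  coeff-+ₚ (x ∷ p) (y ∷ q) (suc i) = coeff-+ₚ p q i

  coeff-scale : ∀ a q → coeff (scale a q) ≐ a ·ˢ coeff q
  coeff-scale a []      i       = sym (zeroʳ a)
  coeff-scale a (x ∷ q) zero    = refl
  coeff-scale a (x ∷ q) (suc i) = coeff-scale a q i

  coeff-∷-*ₚ : ∀ a p q → coeff ((a ∷ p) *ₚ q) ≐ a ·ˢ coeff q +ˢ shift 1 (coeff (p *ₚ q))
  coeff-∷-*ₚ a p q zero    = trans (coeff-+ₚ (scale a q) _ 0) (+-congʳ (coeff-scale a q 0))
  coeff-∷-*ₚ a p q (suc i) = trans (coeff-+ₚ (scale a q) _ (suc i)) (+-congʳ (coeff-scale a q (suc i)))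

  coeff-*ₚ-oneₚ : ∀ p → coeff (p *ₚ oneₚ) ≐ coeff p
  coeff-*ₚ-oneₚ []      i       = refl
  coeff-*ₚ-oneₚ (a ∷ p) zero    = trans (coeff-∷-*ₚ a p oneₚ 0) (trans (+-identityʳ _) (*-identityʳ a))
  coeff-*ₚ-oneₚ (a ∷ p) (suc i) = begin
    coeff ((a ∷ p) *ₚ oneₚ) (suc i)  ≈⟨ coeff-∷-*ₚ a p oneₚ (suc i) ⟩
    a * 0# + coeff (p *ₚ oneₚ) i     ≈⟨ +-cong (zeroʳ a) (coeff-*ₚ-oneₚ p i) ⟩
    0# + coeff p i                   ≈⟨ +-identityˡ _ ⟩
    coeff p i                        ∎

  coeff-*ₚ-Δ : ∀ e q r → coeff r ≐ Δ e (coeff q) → ∀ p → coeff (p *ₚ r) ≐ Δ e (coeff (p *ₚ q))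
  coeff-*ₚ-Δ e q r r≐Δq []      i = sym (IsLinear.0-homo (Δ-isLinear e) i)
  coeff-*ₚ-Δ e q r r≐Δq (a ∷ p) i = begin
    coeff ((a ∷ p) *ₚ r) i
      ≈⟨ coeff-∷-*ₚ a p r i ⟩
    a * coeff r i + shift 1 (coeff (p *ₚ r)) i
      ≈⟨ +-cong (*-congˡ (r≐Δq i)) (IsLinear.cong (shift-isLinear 1) (coeff-*ₚ-Δ e q r r≐Δq p) i) ⟩
    a * Δ e (coeff q) i + shift 1 (Δ e (coeff (p *ₚ q))) i
      ≈⟨ +-cong (sym (D.*-homo a (coeff q) i)) (sym (Δ-shift e 1 _ i)) ⟩
    Δ e (a ·ˢ coeff q) i + Δ e (shift 1 (coeff (p *ₚ q))) i
      ≈⟨ D.+-homo _ _ i ⟨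
    Δ e (a ·ˢ coeff q +ˢ shift 1 (coeff (p *ₚ q))) i
      ≈⟨ D.cong (coeff-∷-*ₚ a p q) i ⟨
    Δ e (coeff ((a ∷ p) *ₚ q)) i
      ∎
    where module D = IsLinear (Δ-isLinear e)

  coeff-oneMinusXPow : ∀ e → coeff (oneMinusXPow e) ≐ Δ e (coeff oneₚ)
  coeff-oneMinusXPow zero    i       = sym (-‿inverseʳ _)
  coeff-oneMinusXPow (suc e) zero    = sym (x-0≈x 1#)
  coeff-oneMinusXPow (suc e) (suc i) = trans (coeff-−xᵉ e i) (sym (+-identityˡ _))
    where
    coeff-−xᵉ : ∀ e i → coeff (replicate e 0# ++ [ - 1# ]) i ≈ - shift e (coeff oneₚ) i
    coeff-−xᵉ zero    zero    = refl
    coeff-−xᵉ zero    (suc i) = sym ε⁻¹≈ε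
    coeff-−xᵉ (suc e) zero    = sym ε⁻¹≈ε
    coeff-−xᵉ (suc e) (suc i) = coeff-−xᵉ e i

  coeff-*ₚ-oneMinusXPow : ∀ e p → coeff (p *ₚ oneMinusXPow e) ≐ Δ e (coeff p)
  coeff-*ₚ-oneMinusXPow e p i =
    trans (coeff-*ₚ-Δ e oneₚ _ (coeff-oneMinusXPow e) p i) (IsLinear.cong (Δ-isLinear e) (coeff-*ₚ-oneₚ p) i)

  coeff-*ₚ-prodFactors : ∀ b N p → coeff (p *ₚ prodFactors b N) ≐ ΔΠ b N (coeff p)
  coeff-*ₚ-prodFactors b zero    p = coeff-*ₚ-oneₚ p
  coeff-*ₚ-prodFactors b (suc N) p i = begin
    coeff (p *ₚ (prodFactors b N *ₚ oneMinusXPow (b ^ N))) i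
      ≈⟨ coeff-*ₚ-Δ (b ^ N) (prodFactors b N) _ (coeff-*ₚ-oneMinusXPow (b ^ N) (prodFactors b N)) p i ⟩
    Δ (b ^ N) (coeff (p *ₚ prodFactors b N)) i
      ≈⟨ IsLinear.cong (Δ-isLinear (b ^ N)) (coeff-*ₚ-prodFactors b N p) i ⟩
    ΔΠ b (suc N) (coeff p) i
      ∎

module Digits (b : ℕ) .{{_ : NonZero b}} (b≥2 : 2 ≤ b) where
  open import Data.Nat using (_+_; _*_; _≤′_; ≤′-refl; ≤′-step)
  open import Data.Nat.DivMod
  open import Data.Nat.Solver using (module +-*-Solver)
  open import Data.Bool using (_∧_)
  open import Data.Sum using (inj₁; inj₂)
  open import Data.Bool.Properties using (T-∧)
  open import Data.Fin.Properties using (toℕ-injective; toℕ-fromℕ<)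
  open import Function.Bundles using (Equivalence)
  open ≡ using (refl; cong; cong₂)

  0≢b∸1 : 0 ≢ b ∸ 1
  0≢b∸1 0≡b∸1 = ℕₚ.<-irrefl 0≡b∸1 (ℕₚ.∸-monoˡ-≤ 1 b≥2)

  1+[b∸1]≡b : suc (b ∸ 1) ≡ b
  1+[b∸1]≡b = ℕₚ.m+[n∸m]≡n (ℕₚ.<-≤-trans (s≤s z≤n) b≥2)

  n<b^n : ∀ n → n < b ^ n
  n<b^n zero    = s≤s z≤n
  n<b^n (suc n) = begin-strict
    suc n            <⟨ ℕₚ.+-mono-≤ {1} (ℕₚ.m^n>0 b n) (n<b^n n) ⟩
    b ^ n + b ^ n    ≡⟨ cong (b ^ n +_) (ℕₚ.+-identityʳ (b ^ n)) ⟨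
    2 * b ^ n        ≤⟨ ℕₚ.*-monoˡ-≤ (b ^ n) b≥2 ⟩
    b ^ suc n        ∎
    where open ℕₚ.≤-Reasoning

  digit-small : ∀ {K} j {n} → n < b ^ K → K ≤ j → digit b j n ≡ 0
  digit-small j {n} n< K≤j = begin
    n / b ^ j % b  ≡⟨ cong (_% b) (m<n⇒m/n≡0 (ℕₚ.<-≤-trans n< (ℕₚ.^-monoʳ-≤ b K≤j))) ⟩
    0 % b          ≡⟨ m<n⇒m%n≡m (ℕₚ.<-≤-trans (s≤s z≤n) b≥2) ⟩
    0              ∎
    where
    open ≡.≡-Reasoning
    instance
      b^j≢0 : NonZero (b ^ j)
      b^j≢0 = ℕₚ.m^n≢0 b j

  digit-top : ∀ N {m d} → m < b ^ N → d < b → digit b N (m + d * b ^ N) ≡ d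
  digit-top N {m} {d} m< d< = begin
    (m + d * b ^ N) / b ^ N % b  ≡⟨ cong (_% b) ([m+kn]/n≡m/n+k m d (b ^ N)) ⟩
    (m / b ^ N + d) % b          ≡⟨ cong (λ x → (x + d) % b) (m<n⇒m/n≡0 m<) ⟩
    d % b                        ≡⟨ m<n⇒m%n≡m d< ⟩
    d                            ∎
    where
    open ≡.≡-Reasoning
    instance
      b^N≢0 : NonZero (b ^ N)
      b^N≢0 = ℕₚ.m^n≢0 b N

  digit-+-b^[1+j]-multiple : ∀ j m k → digit b j (m + k * b ^ suc j) ≡ digit b j m
  digit-+-b^[1+j]-multiple j m k = begin
    (m + k * (b * b ^ j)) / b ^ j % b  ≡⟨ cong (λ x → (m + x) / b ^ j % b) (ℕₚ.*-assoc k b (b ^ j)) ⟨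
    (m + k * b * b ^ j) / b ^ j % b    ≡⟨ cong (_% b) ([m+kn]/n≡m/n+k m (k * b) (b ^ j)) ⟩
    (m / b ^ j + k * b) % b            ≡⟨ [m+kn]%n≡m%n (m / b ^ j) k b ⟩
    m / b ^ j % b                      ∎
    where
    open ≡.≡-Reasoning
    instance
      b^j≢0 : NonZero (b ^ j)
      b^j≢0 = ℕₚ.m^n≢0 b j

  digit-low : ∀ {j N} m d → j < N → digit b j (m + d * b ^ N) ≡ digit b j m
  digit-low {j} m d j<N with ℕₚ.m≤n⇒∃[o]m+o≡n j<N
  ... | o , refl = ≡.trans (cong (λ x → digit b j (m + x)) d*b^[1+j+o])
                           (digit-+-b^[1+j]-multiple j m (d * b ^ o))
    where
    open +-*-Solver
    d*b^[1+j+o] : d * b ^ (suc j + o) ≡ d * b ^ o * b ^ suc j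
    d*b^[1+j+o] = ≡.trans (cong (d *_) (ℕₚ.^-distribˡ-+-* b (suc j) o))
                          (solve 3 (λ d B O → d :* (B :* O) := d :* O :* B) refl d (b ^ suc j) (b ^ o))

  m+d*b^N<b^[1+N] : ∀ N {m d} → m < b ^ N → d < b → m + d * b ^ N < b ^ suc N
  m+d*b^N<b^[1+N] N {m} {d} m< d< = ℕₚ.<-≤-trans (ℕₚ.+-monoˡ-< (d * b ^ N) m<) (ℕₚ.*-monoˡ-≤ (b ^ N) d<)

  data LeadingDigit (N : ℕ) : ℕ → Set where
    leading : ∀ {m d} → m < b ^ N → d < b → LeadingDigit N (m + d * b ^ N)

  leadingDigit : ∀ N {k} → k < b ^ suc N → LeadingDigit N k
  leadingDigit N {k} k< = ≡.subst (LeadingDigit N) (≡.sym (m≡m%n+[m/n]*n k (b ^ N)))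
                                 (leading (m%n<n k (b ^ N)) (m<n*o⇒m/o<n k<))
    where
    instance
      b^N≢0 : NonZero (b ^ N)
      b^N≢0 = ℕₚ.m^n≢0 b N

  digitSumUpTo-stable : ∀ {K K′ n} → n < b ^ K → K ≤′ K′ → digitSumUpTo b K′ n ≡ digitSumUpTo b K n
  digitSumUpTo-stable n< ≤′-refl            = refl
  digitSumUpTo-stable {K′ = suc K′} n< (≤′-step K≤′K′) =
    cong₂ _+_ (digit-small K′ n< (ℕₚ.≤′⇒≤ K≤′K′)) (digitSumUpTo-stable n< K≤′K′)

  digitSum≡digitSumUpTo : ∀ K {n} → n < b ^ K → digitSum b n ≡ digitSumUpTo b K n
  digitSum≡digitSumUpTo K {n} n< with ℕₚ.≤-total K (suc n)
  ... | inj₁ K≤1+n = digitSumUpTo-stable n< (ℕₚ.≤⇒≤′ K≤1+n)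
  ... | inj₂ 1+n≤K = ≡.sym (digitSumUpTo-stable (ℕₚ.<-trans (ℕₚ.n<1+n n) (n<b^n (suc n))) (ℕₚ.≤⇒≤′ 1+n≤K))

  digitSumUpTo-low : ∀ K N m d → K ≤ N → digitSumUpTo b K (m + d * b ^ N) ≡ digitSumUpTo b K m
  digitSumUpTo-low zero    N m d _   = refl
  digitSumUpTo-low (suc K) N m d K<N = cong₂ _+_ (digit-low m d K<N) (digitSumUpTo-low K N m d (ℕₚ.<⇒≤ K<N))

  digitSum-split : ∀ N {m d} → m < b ^ N → d < b → digitSum b (m + d * b ^ N) ≡ d + digitSum b m
  digitSum-split N {m} {d} m< d< = begin
    digitSum b (m + d * b ^ N)
      ≡⟨ digitSum≡digitSumUpTo (suc N) (m+d*b^N<b^[1+N] N m< d<) ⟩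
    digit b N (m + d * b ^ N) + digitSumUpTo b N (m + d * b ^ N)
      ≡⟨ cong₂ _+_ (digit-top N m< d<) (digitSumUpTo-low N N m d ℕₚ.≤-refl) ⟩
    d + digitSumUpTo b N m
      ≡⟨ cong (d +_) (digitSum≡digitSumUpTo N m<) ⟨
    d + digitSum b m
      ∎
    where open ≡.≡-Reasoning

  %-≡⇒mod-≡ : ∀ {m n} → m % b ≡ n % b → m mod b ≡ n mod b
  %-≡⇒mod-≡ m%b≡n%b = toℕ-injective (≡.trans (toℕ-fromℕ< _) (≡.trans m%b≡n%b (≡.sym (toℕ-fromℕ< _))))

  u-split-digit : ∀ N {m d} → m < b ^ N → d < b → u b (m + d * b ^ N) ≡ (toℕ (u b m) + d) mod b
  u-split-digit N {m} {d} m< d< = %-≡⇒mod-≡ (begin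
    digitSum b (m + d * b ^ N) % b    ≡⟨ cong (_% b) (digitSum-split N m< d<) ⟩
    (d + digitSum b m) % b            ≡⟨ cong (_% b) (ℕₚ.+-comm d _) ⟩
    (digitSum b m + d) % b            ≡⟨ [m%n+k]%n≡[m+k]%n (digitSum b m) d b ⟨
    (digitSum b m % b + d) % b        ≡⟨ cong (λ x → (x + d) % b) (toℕ-fromℕ< _) ⟨
    (toℕ (u b m) + d) % b             ∎)
    where open ≡.≡-Reasoning

  domUpTo-stable : ∀ {K K′ k} n → k < b ^ K → K ≤′ K′ → domUpTo b K′ k n ≡ domUpTo b K k n
  domUpTo-stable n k< ≤′-refl = refl
  domUpTo-stable {K′ = suc K′} n k< (≤′-step K≤′K′)
    rewrite digit-small K′ k< (ℕₚ.≤′⇒≤ K≤′K′) = domUpTo-stable n k< K≤′K′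

  dom?≡domUpTo : ∀ K {k n} → k ≤ n → n < b ^ K → dom? b k n ≡ domUpTo b K k n
  dom?≡domUpTo K {k} {n} k≤n n< with ℕₚ.≤-total K (suc n)
  ... | inj₁ K≤1+n = domUpTo-stable n (ℕₚ.≤-<-trans k≤n n<) (ℕₚ.≤⇒≤′ K≤1+n)
  ... | inj₂ 1+n≤K = ≡.sym (domUpTo-stable n (ℕₚ.<-trans (s≤s k≤n) (n<b^n (suc n))) (ℕₚ.≤⇒≤′ 1+n≤K))

  domUpTo-low : ∀ K N k m d′ d → K ≤ N → domUpTo b K (k + d′ * b ^ N) (m + d * b ^ N) ≡ domUpTo b K k m
  domUpTo-low zero    N k m d′ d _   = refl
  domUpTo-low (suc K) N k m d′ d K<N =
    cong₂ _∧_ (cong₂ _≤ᵇ_ (digit-low k d′ K<N) (digit-low m d K<N)) (domUpTo-low K N k m d′ d (ℕₚ.<⇒≤ K<N))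

  domUpTo-split : ∀ N {k m d′ d} → k < b ^ N → m < b ^ N → d′ < b → d < b →
                  domUpTo b (suc N) (k + d′ * b ^ N) (m + d * b ^ N) ≡ (d′ ≤ᵇ d) ∧ domUpTo b N k m
  domUpTo-split N {k} {m} {d′} {d} k< m< d′< d< =
    cong₂ _∧_ (cong₂ _≤ᵇ_ (digit-top N k< d′<) (digit-top N m< d<)) (domUpTo-low N N k m d′ d ℕₚ.≤-refl)

  domUpTo⇒≤ : ∀ K {k n} → k < b ^ K → n < b ^ K → T (domUpTo b K k n) → k ≤ n
  domUpTo⇒≤ zero    (s≤s z≤n) _  _ = z≤n
  domUpTo⇒≤ (suc N) k< n< k⪯n with leadingDigit N k< | leadingDigit N n<
  ... | leading {k′} {d′} k′< d′< | leading {m} {d} m< d<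
    with Equivalence.to T-∧ (≡.subst T (domUpTo-split N k′< m< d′< d<) k⪯n)
  ... | d′≤d , k′⪯m =
    ℕₚ.+-mono-≤ (domUpTo⇒≤ N k′< m< k′⪯m) (ℕₚ.*-monoˡ-≤ (b ^ N) (ℕₚ.≤ᵇ⇒≤ d′ d d′≤d))

module ZeroSumVectors {c ℓ : Level} (R : CommutativeRing c ℓ) (b : ℕ) .{{_ : NonZero b}} (b≥2 : 2 ≤ b) where
  open CommutativeRing R
  open Poly R
  open FiniteSums R
  open Sequences R
  open Digits b b≥2
  open import Data.Nat.DivMod using (_mod_; m<n⇒m%n≡m; [m+n]%n≡m%n)
  open import Data.Fin.Properties using (toℕ-injective; toℕ-fromℕ<; toℕ<n)
  open import Data.Bool.Properties using (if-∧)
  open import Relation.Binary.Definitions using (tri<; tri≈; tri>)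
  open import Relation.Binary.Reasoning.Setoid setoid

  Vector : Set c
  Vector = Fin b → Carrier

  periodic : Vector → ℕ → Carrier
  periodic a j = a (j mod b)

  rotate : Vector → ℕ → Vector
  rotate a d x = periodic a (toℕ x ℕ.+ d)

  periodic-toℕ : ∀ a x → periodic a (toℕ x) ≡ a x
  periodic-toℕ a x = ≡.cong a (toℕ-injective (≡.trans (toℕ-fromℕ< _) (m<n⇒m%n≡m (toℕ<n x))))

  periodic-+b : ∀ a t → periodic a (b ℕ.+ t) ≈ periodic a t
  periodic-+b a t = reflexive (≡.cong a (%-≡⇒mod-≡ (≡.trans (≡.cong (_% b) (ℕₚ.+-comm b t)) ([m+n]%n≡m%n t b))))

  periodic-sum : ∀ a → ZeroSum b a → sumTo b (periodic a) ≈ 0#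
  periodic-sum a Σa≈0 = begin
    sumTo b (periodic a)          ≈⟨ sumFin≈sumTo b (periodic a) ⟨
    sumFin b (periodic a ∘ toℕ)   ≈⟨ sumFin-cong b (λ x → reflexive (periodic-toℕ a x)) ⟩
    sumFin b a                    ≈⟨ Σa≈0 ⟩
    0#                            ∎

  rotate-zeroSum : ∀ a → ZeroSum b a → ∀ d → ZeroSum b (rotate a d)
  rotate-zeroSum a Σa≈0 d = begin
    sumFin b (λ x → periodic a (toℕ x ℕ.+ d))
      ≈⟨ sumFin≈sumTo b (λ j → periodic a (j ℕ.+ d)) ⟩
    sumTo b (λ j → periodic a (j ℕ.+ d))
      ≈⟨ sumTo-cong b (λ j _ → reflexive (≡.cong (periodic a) (ℕₚ.+-comm j d))) ⟩
    sumTo b (λ j → periodic a (d ℕ.+ j))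
      ≈⟨ sumTo-periodic b (periodic a) (periodic-+b a) d ⟩
    sumTo b (periodic a)
      ≈⟨ periodic-sum a Σa≈0 ⟩
    0#
      ∎

  rotations-sum : ∀ a → ZeroSum b a → ∀ x → sumTo b (λ d → rotate a d x) ≈ 0#
  rotations-sum a Σa≈0 x = trans (sumTo-periodic b (periodic a) (periodic-+b a) (toℕ x)) (periodic-sum a Σa≈0)

  u-split : ∀ N a {m d} → m < b ^ N → d < b → a (u b (m ℕ.+ d ℕ.* b ^ N)) ≡ rotate a d (u b m)
  u-split N a m< d< = ≡.cong a (u-split-digit N m< d<)

  -- Unlike cc, which sums over k ≤ n, this sums over all k < b^K, as the block decomposition needs.
  cBelow : ℕ → Vector → ℕ → Carrier
  cBelow K a n = sumTo (b ^ K) (λ k → if domUpTo b K k n then a (u b k) else 0#)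

  cc≈cBelow : ∀ K a {n} → n < b ^ K → cc b a n ≈ cBelow K a n
  cc≈cBelow K a {n} n< = begin
    cc b a n
      ≈⟨ sumTo-cong (suc n) dom?≈domUpTo ⟩
    sumTo (suc n) (λ k → if domUpTo b K k n then a (u b k) else 0#)
      ≈⟨ sumTo-zero-tail (suc n) (b ^ K) n< not-dominated ⟨
    cBelow K a n
      ∎
    where
    dom?≈domUpTo : ∀ k → k < suc n →
                   (if dom? b k n then a (u b k) else 0#) ≈ (if domUpTo b K k n then a (u b k) else 0#)
    dom?≈domUpTo k k<1+n =
      reflexive (≡.cong (λ x → if x then a (u b k) else 0#) (dom?≡domUpTo K (ℕₚ.≤-pred k<1+n) n<))
    not-dominated : ∀ k → suc n ≤ k → k < b ^ K → (if domUpTo b K k n then a (u b k) else 0#) ≈ 0#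
    not-dominated k n<k k< = reflexive (if-¬T (λ k⪯n → ℕₚ.<⇒≱ n<k (domUpTo⇒≤ K k< n< k⪯n)))

  cBelow-split : ∀ N a {m d} → m < b ^ N → d < b →
                 cBelow (suc N) a (m ℕ.+ d ℕ.* b ^ N) ≈ sumTo (suc d) (λ d′ → cBelow N (rotate a d′) m)
  cBelow-split N a {m} {d} m< d< = begin
    sumTo (b ℕ.* b ^ N) f
      ≈⟨ sumTo-blocks b (b ^ N) f ⟩
    sumTo b (λ d′ → sumTo (b ^ N) (λ k → f (k ℕ.+ d′ ℕ.* b ^ N)))
      ≈⟨ sumTo-cong b (λ d′ d′< → trans (sumTo-cong (b ^ N) (λ k k< → reflexive (block d′< k<)))
                                        (sumTo-if (b ^ N) (d′ ≤ᵇ d) _)) ⟩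
    sumTo b (λ d′ → if d′ ≤ᵇ d then cBelow N (rotate a d′) m else 0#)
      ≈⟨ sumTo-zero-tail (suc d) b d< (λ d′ d<d′ _ → reflexive (if-¬T (ℕₚ.<⇒≱ d<d′ ∘ ℕₚ.≤ᵇ⇒≤ d′ d))) ⟩
    sumTo (suc d) (λ d′ → if d′ ≤ᵇ d then cBelow N (rotate a d′) m else 0#)
      ≈⟨ sumTo-cong (suc d) (λ d′ d′<1+d → reflexive (if-T (ℕₚ.≤⇒≤ᵇ (ℕₚ.≤-pred d′<1+d)))) ⟩
    sumTo (suc d) (λ d′ → cBelow N (rotate a d′) m)
      ∎
    where
    f : ℕ → Carrier
    f k = if domUpTo b (suc N) k (m ℕ.+ d ℕ.* b ^ N) then a (u b k) else 0#
    block : ∀ {d′ k} → d′ < b → k < b ^ N →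
            f (k ℕ.+ d′ ℕ.* b ^ N)
              ≡ (if d′ ≤ᵇ d then (if domUpTo b N k m then rotate a d′ (u b k) else 0#) else 0#)
    block {d′} d′< k< =
      ≡.trans (≡.cong₂ (λ x y → if x then y else 0#) (domUpTo-split N k< m< d′< d<) (u-split N a k< d′<))
              (if-∧ (d′ ≤ᵇ d))

  cc-split : ∀ N a {m d} → m < b ^ N → d < b →
             cc b a (m ℕ.+ d ℕ.* b ^ N) ≈ sumTo (suc d) (λ d′ → cc b (rotate a d′) m)
  cc-split N a {m} {d} m< d< = begin
    cc b a (m ℕ.+ d ℕ.* b ^ N)
      ≈⟨ cc≈cBelow (suc N) a (m+d*b^N<b^[1+N] N m< d<) ⟩
    cBelow (suc N) a (m ℕ.+ d ℕ.* b ^ N)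
      ≈⟨ cBelow-split N a m< d< ⟩
    sumTo (suc d) (λ d′ → cBelow N (rotate a d′) m)
      ≈⟨ sumTo-cong (suc d) (λ d′ _ → cc≈cBelow N (rotate a d′) m<) ⟨
    sumTo (suc d) (λ d′ → cc b (rotate a d′) m)
      ∎

  ΔΠ-restrict-cc : ∀ N a → ZeroSum b a → ΔΠ b N (restrict (b ^ N) (cc b a)) ≐ restrict (b ^ N) (a ∘ u b)
  ΔΠ-restrict-cc zero    a Σa≈0 zero    = trans (cc≈cBelow 0 a (s≤s z≤n)) (+-identityˡ _)
  ΔΠ-restrict-cc zero    a Σa≈0 (suc i) = refl
  ΔΠ-restrict-cc (suc N) a Σa≈0 i = begin
    Δ E (ΔΠ b N (restrict (b ℕ.* E) (cc b a))) i
      ≈⟨ ΔE.cong (ΠN.cong cc-blocks) i ⟩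
    Δ E (ΔΠ b N (Σˢ b (λ d → shift (d ℕ.* E) (restrict E (Σˢ (suc d) (cc b ∘ rotate a)))))) i
      ≈⟨ ΔE.cong (λ j → trans (ΠN.Σ-homo b _ j) (sumTo-cong b (λ d _ → ΔΠ-block d j))) i ⟩
    Δ E (Σˢ b (λ d → shift (d ℕ.* E) (Σˢ (suc d) g))) i
      ≈⟨ Δ-telescope E b g i ⟩
    Σˢ b (λ d → shift (d ℕ.* E) (g d)) i - shift (b ℕ.* E) (Σˢ b g) i
      ≈⟨ +-congˡ (-‿cong (trans (IsLinear.cong (shift-isLinear (b ℕ.* E)) Σg≈0 i)
                                (IsLinear.0-homo (shift-isLinear (b ℕ.* E)) i))) ⟩
    Σˢ b (λ d → shift (d ℕ.* E) (g d)) i - 0#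
      ≈⟨ x-0≈x _ ⟩
    Σˢ b (λ d → shift (d ℕ.* E) (g d)) i
      ≈⟨ F-blocks i ⟨
    restrict (b ℕ.* E) (a ∘ u b) i
      ∎
    where
    E : ℕ
    E = b ^ N
    module ΔE = IsLinear (Δ-isLinear E)
    module ΠN = IsLinear (ΔΠ-isLinear b N)
    module RE = IsLinear (restrict-isLinear E)

    g : ℕ → Seq
    g d′ = restrict E (rotate a d′ ∘ u b)

    IH : ∀ d′ → ΔΠ b N (restrict E (cc b (rotate a d′))) ≐ g d′
    IH d′ = ΔΠ-restrict-cc N (rotate a d′) (rotate-zeroSum a Σa≈0 d′)

    cc-blocks : restrict (b ℕ.* E) (cc b a)
                  ≐ Σˢ b (λ d → shift (d ℕ.* E) (restrict E (Σˢ (suc d) (cc b ∘ rotate a))))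
    cc-blocks = restrict-blocks E b (cc b a) _ (λ d m d< m< → cc-split N a m< d<)

    F-blocks : restrict (b ℕ.* E) (a ∘ u b) ≐ Σˢ b (λ d → shift (d ℕ.* E) (g d))
    F-blocks = restrict-blocks E b (a ∘ u b) _ (λ d m d< m< → reflexive (u-split N a m< d<))

    ΔΠ-block : ∀ d → ΔΠ b N (shift (d ℕ.* E) (restrict E (Σˢ (suc d) (cc b ∘ rotate a))))
                       ≐ shift (d ℕ.* E) (Σˢ (suc d) g)
    ΔΠ-block d j = begin
      ΔΠ b N (shift (d ℕ.* E) (restrict E (Σˢ (suc d) (cc b ∘ rotate a)))) j
        ≈⟨ ΔΠ-shift b N (d ℕ.* E) _ j ⟩
      shift (d ℕ.* E) (ΔΠ b N (restrict E (Σˢ (suc d) (cc b ∘ rotate a)))) j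
        ≈⟨ Sd.cong (λ k → trans (ΠN.cong (RE.Σ-homo (suc d) _) k) (ΠN.Σ-homo (suc d) _ k)) j ⟩
      shift (d ℕ.* E) (Σˢ (suc d) (λ d′ → ΔΠ b N (restrict E (cc b (rotate a d′))))) j
        ≈⟨ Sd.cong (λ k → sumTo-cong (suc d) (λ d′ _ → IH d′ k)) j ⟩
      shift (d ℕ.* E) (Σˢ (suc d) g) j
        ∎
      where module Sd = IsLinear (shift-isLinear (d ℕ.* E))

    Σg≈0 : Σˢ b g ≐ 0ˢ
    Σg≈0 k = begin
      Σˢ b g k                                                   ≈⟨ RE.Σ-homo b (λ d′ → rotate a d′ ∘ u b) k ⟨
      restrict E (λ n → sumTo b (λ d′ → rotate a d′ (u b n))) k  ≈⟨ RE.cong (rotations-sum a Σa≈0 ∘ u b) k ⟩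
      restrict E 0ˢ k                                            ≈⟨ RE.0-homo k ⟩
      0#                                                         ∎

  rotations-cc-sum : ∀ a → ZeroSum b a → ∀ m → sumTo b (λ d′ → cc b (rotate a d′) m) ≈ 0#
  rotations-cc-sum a Σa≈0 m = begin
    sumTo b (λ d′ → sumTo (suc m) (λ k → if dom? b k m then rotate a d′ (u b k) else 0#))
      ≈⟨ sumTo-comm b (suc m) _ ⟩
    sumTo (suc m) (λ k → sumTo b (λ d′ → if dom? b k m then rotate a d′ (u b k) else 0#))
      ≈⟨ sumTo-zero (suc m) (λ k _ → column k) ⟩
    0#
      ∎
    where
    if-≈0 : ∀ x {y} → y ≈ 0# → (if x then y else 0#) ≈ 0#
    if-≈0 true  y≈0 = y≈0
    if-≈0 false _   = refl
    column : ∀ k → sumTo b (λ d′ → if dom? b k m then rotate a d′ (u b k) else 0#) ≈ 0#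
    column k = trans (sumTo-if b (dom? b k m) _) (if-≈0 (dom? b k m) (rotations-sum a Σa≈0 (u b k)))

  cc-vanishes : ∀ N a → ZeroSum b a → ∀ n → n < b ^ N → hasDigit b (b ∸ 1) n → cc b a n ≈ 0#
  cc-vanishes zero    a Σa≈0 zero    _         (j , digit≡b∸1) =
    ⊥-elim (0≢b∸1 (≡.trans (≡.sym (digit-small {0} j (s≤s z≤n) z≤n)) digit≡b∸1))
  cc-vanishes zero    a Σa≈0 (suc n) (s≤s ())
  cc-vanishes (suc N) a Σa≈0 n n< (j , digit≡b∸1) with leadingDigit N n<
  ... | leading {m} {d} m< d< with ℕₚ.<-cmp j N
  ... | tri< j<N _ _ = trans (cc-split N a m< d<) (sumTo-zero (suc d) (λ d′ _ →
          cc-vanishes N (rotate a d′) (rotate-zeroSum a Σa≈0 d′) m m< (j , digit-m≡b∸1)))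
    where
    digit-m≡b∸1 : digit b j m ≡ b ∸ 1
    digit-m≡b∸1 = ≡.trans (≡.sym (digit-low m d j<N)) digit≡b∸1
  ... | tri≈ _ ≡.refl _ = begin
    cc b a (m ℕ.+ d ℕ.* b ^ N)                   ≈⟨ cc-split N a m< d< ⟩
    sumTo (suc d) (λ d′ → cc b (rotate a d′) m)  ≡⟨ ≡.cong (λ k → sumTo k (λ d′ → cc b (rotate a d′) m)) 1+d≡b ⟩
    sumTo b (λ d′ → cc b (rotate a d′) m)        ≈⟨ rotations-cc-sum a Σa≈0 m ⟩
    0#                                           ∎
    where
    1+d≡b : suc d ≡ b
    1+d≡b = ≡.trans (≡.cong suc (≡.trans (≡.sym (digit-top N m< d<)) digit≡b∸1)) 1+[b∸1]≡b
  ... | tri> _ _ N<j =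
    ⊥-elim (0≢b∸1 (≡.trans (≡.sym (digit-small j (m+d*b^N<b^[1+N] N m< d<) N<j)) digit≡b∸1))

theorem3p6 : {c ℓ : Level} (R : CommutativeRing c ℓ)
    → (b : ℕ) .{{_ : NonZero b}} → 2 ≤ b
    → (N : ℕ) → 1 ≤ N
    → (a : Fin b → CommutativeRing.Carrier R)
    → Poly.ZeroSum R b a
    → Poly._≈ₚ_ R (Poly.F R b a N) (Poly._*ₚ_ R (Poly.P R b a N) (Poly.prodFactors R b N))
      × (∀ n → n < b ^ N → hasDigit b (b ∸ 1) n → CommutativeRing._≈_ R (Poly.cc R b a n) (CommutativeRing.0# R))
theorem3p6 R b b≥2 N _ a Σa≈0 = F≈P*prodFactors , cc-vanishes N a Σa≈0
  where
  open CommutativeRing R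
  open Poly R
  open Sequences R
  open PolynomialProducts R
  open ZeroSumVectors R b b≥2
  open import Relation.Binary.Reasoning.Setoid setoid

  F≈P*prodFactors : F b a N ≈ₚ (P b a N *ₚ prodFactors b N)
  F≈P*prodFactors i = begin
    restrict (b ^ N) (a ∘ u b) i             ≈⟨ ΔΠ-restrict-cc N a Σa≈0 i ⟨
    ΔΠ b N (restrict (b ^ N) (cc b a)) i     ≈⟨ coeff-*ₚ-prodFactors b N (P b a N) i ⟨
    coeff (P b a N *ₚ prodFactors b N) i     ∎
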